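{- Let $T$ be an arbitrary support and $k\in\mathbb{N}$. Then $L(M_k^T,n)\gtrsim \frac{2^n}{n}$ as $n\to\infty$.
   Context: Boolean circuits are over the standard basis $\{\vee,\&,\neg\}$ (directed acyclic graphs of inputs and gates, with designated outputs). A support is a nonempty graph (multiple edges and loops allowed) with finitely or countably many vertices. An embedding of a Boolean circuit $S$ into a support $T$ is a graph homomorphism $h\colon S\to T$ (vertices to vertices, each wire $uv$ to an edge of $T$ joining $h(u)$ and $h(v)$). A $k$-layer circuit with support $T$ is a pair $(S,h)$ such that every vertex of $T$ is the image of at most one vertex of $S$ computing a non-constant Boolean function and every edge of $T$ is the image of at most $k$ wires of $S$; $M_k^T$ is the set of these. The complexity of $(S,h)$ is the number of vertices of $T$ in the image of $h$; $L(M_k^T,f)$ is the minimal complexity of a circuit of $M_k^T$ computing $f$ ($\infty$ if none), and $L(M_k^T,n)=\max_{f\in B_n}L(M_k^T,f)$, $B_n$ the Boolean functions of $n$ variables. $F\gtrsim G$ means $\liminf F/G\ge1$. -}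

module Defs where

open import Data.Nat using (ℕ; zero; suc; _+_; _*_; _^_; _≤_; _≟_)
open import Data.Bool using (Bool; _∧_; _∨_; not)
open import Data.Fin using (Fin; zero; suc)
open import Data.List using (List; length; map; deduplicate; allFin)
open import Data.Product using (Σ; Σ-syntax; ∃; ∃-syntax; _×_; _,_)
open import Data.Sum using (_⊎_; inj₁; inj₂)
open import Data.Empty using (⊥)
open import Relation.Nullary using (¬_)
open import Relation.Binary.PropositionalEquality using (_≡_; _≢_)
open import Function using (_∘_)
open import Function.Definitions using (Injective)

-- Supports: nonempty (undirected) graphs with multiple edges and loops,
-- finitely or countably many vertices (and edges).

record Support : Set₁ where
  field
    V        : Set
    E        : Set
    ends     : E → V × V           -- the (unordered) endpoints of an edge
    v₀       : V
    encV     : V → ℕ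
    encV-inj : Injective _≡_ _≡_ encV
    encE     : E → ℕ
    encE-inj : Injective _≡_ _≡_ encE

open Support public

B : ℕ → Set
B n = (Fin n → Bool) → Bool

-- A circuit with n inputs and m gates is built gate by gate; the nodes of
-- 'Circ n m' are 'Fin (m + n)': index 0 is the most recently added gate,
-- and each gate may only read previously present nodes (acyclicity).

data Gate (j : ℕ) : Set where
  AND : Fin j → Fin j → Gate j
  OR  : Fin j → Fin j → Gate j
  NOT : Fin j → Gate j

arity : ∀ {j} → Gate j → ℕ
arity (AND _ _) = 2
arity (OR _ _)  = 2
arity (NOT _)   = 1

arg : ∀ {j} (g : Gate j) → Fin (arity g) → Fin j
arg (AND a b) zero       = a
arg (AND a b) (suc zero) = b
arg (OR a b)  zero       = a
arg (OR a b)  (suc zero) = b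
arg (NOT a)   zero       = a

evalGate : ∀ {j} → Gate j → (Fin j → Bool) → Bool
evalGate (AND a b) v = v a ∧ v b
evalGate (OR a b)  v = v a ∨ v b
evalGate (NOT a)   v = not (v a)

data Circ (n : ℕ) : ℕ → Set where
  []  : Circ n zero
  _▷_ : ∀ {m} → Circ n m → Gate (m + n) → Circ n (suc m)

extend : ∀ {j} → (Fin j → Bool) → Bool → Fin (suc j) → Bool
extend v b zero    = b
extend v b (suc i) = v i

val : ∀ {n m} → Circ n m → (Fin n → Bool) → Fin (m + n) → Bool
val []      x = x
val (C ▷ g) x = extend (val C x) (evalGate g (val C x))

Wire : ∀ {n m} → Circ n m → Set
Wire []      = ⊥
Wire (C ▷ g) = Wire C ⊎ Fin (arity g)

src : ∀ {n m} (C : Circ n m) → Wire C → Fin (m + n)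
src (C ▷ g) (inj₁ w) = suc (src C w)
src (C ▷ g) (inj₂ p) = suc (arg g p)

tgt : ∀ {n m} (C : Circ n m) → Wire C → Fin (m + n)
tgt (C ▷ g) (inj₁ w) = suc (tgt C w)
tgt (C ▷ g) (inj₂ p) = zero

ComputesConst : ∀ {n m} → Circ n m → Fin (m + n) → Set
ComputesConst C u = ∀ x y → val C x u ≡ val C y u

Computes : ∀ {n m} → Circ n m → Fin (m + n) → B n → Set
Computes C o f = ∀ x → val C x o ≡ f x

record Embedding (T : Support) {n m : ℕ} (C : Circ n m) : Set where
  field
    hV   : Fin (m + n) → V T
    hW   : Wire C → E T
    hom  : ∀ w → (ends T (hW w) ≡ (hV (src C w) , hV (tgt C w)))
               ⊎ (ends T (hW w) ≡ (hV (tgt C w) , hV (src C w)))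

open Embedding public

-- (C, h) is a k-layer circuit with support T (membership in M_k^T)
IsKLayer : (T : Support) (k : ℕ) {n m : ℕ} (C : Circ n m) → Embedding T C → Set
IsKLayer T k C h =
  (∀ u v → hV h u ≡ hV h v → ¬ ComputesConst C u → ¬ ComputesConst C v → u ≡ v)
  ×
  -- each edge of T is the image of at most k wires
  (∀ (e : E T) → ¬ (Σ[ ws ∈ (Fin (suc k) → Wire C) ]
                     (Injective _≡_ _≡_ ws × (∀ i → hW h (ws i) ≡ e))))

complexity : (T : Support) {n m : ℕ} (C : Circ n m) → Embedding T C → ℕ
complexity T {n} {m} C h = length (deduplicate _≟_ (map (encV T ∘ hV h) (allFin (m + n))))

-- A k-layer circuit of complexity c has at most c non-constant nodes, since any two of them
-- lie on distinct vertices of T. A depth-first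
-- traversal from the output, which expands each non-constant node once and replaces inputs,
-- constants and revisited nodes by references to previously computed values, turns the circuit
-- into a postfix program with at most 2c + 1 instructions and at most c + 1 references into a
-- memory of n + c + 2 cells. So at most 5^(2c+1) (n + c + 2)^(c+1) Boolean functions of n
-- variables have complexity at most c; for c = d 2^n / ((d + 1) n) and n large this is less
-- than 2^(2^n), leaving some function of larger complexity.

module Submission where

open import Defs
open import Data.Nat using (ℕ; zero; suc; _+_; _*_; _^_; _∸_; _≤_; _<_; _<?_; _≤?_; z≤n; s≤s; z<s; NonZero)
open import Data.Nat.DivMod using (_/_; _%_; m≡m%n+[m/n]*n; m%n<n; m/n*n≤m)
open import Data.Nat.Properties
open import Data.Bool using (Bool; true; false; _∧_; _∨_; not; if_then_else_)
import Data.Bool as Bool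
open import Data.Fin as Fin using (Fin; zero; suc; toℕ; fromℕ<)
open import Data.Fin.Properties using (toℕ<n; toℕ-fromℕ<)
open import Data.Fin.Induction using (>-wellFounded)
open import Data.Vec as Vec using (Vec; []; _∷_; take; drop; toList)
open import Data.Vec.Properties using (take++drop≡id; lookup∘tabulate)
open import Data.List as List using (List; []; _∷_; _++_; _∷ʳ_; [_]; length; map; replicate; tabulate; allFin; cartesianProductWith; cartesianProduct; removeAt; deduplicate)
open import Data.List.Properties using (length-++; length-map; length-tabulate; length-removeAt′; length-++-≤ˡ; ++-assoc; ++-identityʳ; map-++; foldl-++)
open import Data.List.Membership.Propositional using (_∈_; _∉_)
open import Data.List.Membership.Propositional.Properties using (∈-map⁺; ∈-++⁻; ∈-cartesianProductWith⁺; ∈-cartesianProduct⁺; ∈-allFin; ∈-deduplicate⁺)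
open import Data.List.Relation.Unary.Any using (here; there; index)
open import Data.List.Relation.Unary.All as All using (All; []; _∷_)
import Data.List.Relation.Unary.All.Properties as All
open import Data.List.Relation.Unary.Unique.Propositional using (Unique; []; _∷_)
import Data.List.Relation.Unary.Unique.Propositional.Properties as Unique
import Data.List.Relation.Binary.Subset.Propositional.Properties as Subset
open import Data.List.Relation.Binary.Subset.Propositional using (_⊆_)
open import Data.Product as Product using (Σ-syntax; ∃; _×_; _,_; proj₁; proj₂)
open import Data.Sum as Sum using (_⊎_; inj₁; inj₂)
open import Function using (_∘_)
open import Relation.Nullary using (¬_; Dec; yes; no; contradiction)
open import Relation.Nullary.Decidable using (map′)
open import Relation.Unary using (Decidable)
open import Relation.Binary.PropositionalEquality using (_≡_; _≢_; refl; sym; trans; cong; cong₂; subst; _≗_; module ≡-Reasoning)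
open import Induction.WellFounded using (Acc; acc)
open import Data.Nat.Tactic.RingSolver using (solve-∀)

private variable
  X Y Z : Set
  M : ℕ

length-cartesianProductWith : (f : X → Y → Z) (xs : List X) (ys : List Y) →
  length (cartesianProductWith f xs ys) ≡ length xs * length ys
length-cartesianProductWith f []       ys = refl
length-cartesianProductWith f (x ∷ xs) ys = begin
  length (map (f x) ys ++ cartesianProductWith f xs ys)
    ≡⟨ length-++ (map (f x) ys) ⟩
  length (map (f x) ys) + length (cartesianProductWith f xs ys)
    ≡⟨ cong₂ _+_ (length-map (f x) ys) (length-cartesianProductWith f xs ys) ⟩
  length ys + length xs * length ys
    ∎
  where open ≡-Reasoning

vectors : List X → (k : ℕ) → List (Vec X k)
vectors xs zero    = [ [] ]
vectors xs (suc k) = cartesianProductWith _∷_ xs (vectors xs k)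

length-vectors : (xs : List X) (k : ℕ) → length (vectors xs k) ≡ length xs ^ k
length-vectors xs zero    = refl
length-vectors xs (suc k) = trans (length-cartesianProductWith _∷_ xs (vectors xs k))
                                  (cong (length xs *_) (length-vectors xs k))

∈-vectors : {xs : List X} → (∀ a → a ∈ xs) → (v : Vec X M) → v ∈ vectors xs M
∈-vectors complete []      = here refl
∈-vectors complete (a ∷ v) = ∈-cartesianProductWith⁺ _∷_ (complete a) (∈-vectors complete v)

∈-removeAt⁺ : {x y : X} {ys : List X} (x∈ys : x ∈ ys) → y ∈ ys → x ≢ y → y ∈ removeAt ys (index x∈ys)
∈-removeAt⁺ (here refl) (here refl) x≢y = contradiction refl x≢y
∈-removeAt⁺ (here refl) (there y∈ys) _  = y∈ys
∈-removeAt⁺ (there _)   (here refl) _   = here refl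
∈-removeAt⁺ (there x∈ys) (there y∈ys) x≢y = there (∈-removeAt⁺ x∈ys y∈ys x≢y)

Unique⇒length-mono-⊆ : {xs ys : List X} → Unique xs → xs ⊆ ys → length xs ≤ length ys
Unique⇒length-mono-⊆ []                 _     = z≤n
Unique⇒length-mono-⊆ {ys = ys} (x≢xs ∷ u) xs⊆ys = begin
  suc _                                   ≤⟨ s≤s (Unique⇒length-mono-⊆ u xs⊆ys─x) ⟩
  suc (length (removeAt ys (index x∈ys))) ≡⟨ length-removeAt′ ys (index x∈ys) ⟨
  length ys                               ∎
  where
  open ≤-Reasoning
  x∈ys = xs⊆ys (here refl)
  xs⊆ys─x : _ ⊆ removeAt ys (index x∈ys)
  xs⊆ys─x y∈xs = ∈-removeAt⁺ x∈ys (xs⊆ys (there y∈xs)) (All.lookup x≢xs y∈xs)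

Unique-map⁺ : {f : X → Y} {xs : List X} → (∀ {x y} → x ∈ xs → y ∈ xs → f x ≡ f y → x ≡ y) →
  Unique xs → Unique (map f xs)
Unique-map⁺ inj []          = []
Unique-map⁺ inj (x≢xs ∷ u) =
  All.map⁺ (All.tabulate λ y∈xs → All.lookup x≢xs y∈xs ∘ inj (here refl) (there y∈xs))
  ∷ Unique-map⁺ (λ x∈ y∈ → inj (there x∈) (there y∈)) u

Unique-∷ʳ : {x : X} {xs : List X} → Unique xs → x ∉ xs → Unique (xs ∷ʳ x)
Unique-∷ʳ u x∉xs = Unique.++⁺ u ([] ∷ []) λ { (x∈xs , here refl) → x∉xs x∈xs }

splitOnHead : List (Vec Bool (suc M)) → List (Vec Bool M) × List (Vec Bool M)
splitOnHead []                = [] , []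
splitOnHead ((false ∷ v) ∷ vs) = Product.map₁ (v ∷_) (splitOnHead vs)
splitOnHead ((true ∷ v) ∷ vs)  = Product.map₂ (v ∷_) (splitOnHead vs)

length-splitOnHead : (vs : List (Vec Bool (suc M))) →
  length (proj₁ (splitOnHead vs)) + length (proj₂ (splitOnHead vs)) ≡ length vs
length-splitOnHead []                 = refl
length-splitOnHead ((false ∷ v) ∷ vs) = cong suc (length-splitOnHead vs)
length-splitOnHead ((true ∷ v) ∷ vs)  = trans (+-suc _ _) (cong suc (length-splitOnHead vs))

∈-splitOnHead-false : {v : Vec Bool M} (vs : List (Vec Bool (suc M))) →
  (false ∷ v) ∈ vs → v ∈ proj₁ (splitOnHead vs)
∈-splitOnHead-false ((false ∷ w) ∷ vs) (here refl) = here refl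
∈-splitOnHead-false ((false ∷ w) ∷ vs) (there p)   = there (∈-splitOnHead-false vs p)
∈-splitOnHead-false ((true ∷ w) ∷ vs)  (there p)   = ∈-splitOnHead-false vs p

∈-splitOnHead-true : {v : Vec Bool M} (vs : List (Vec Bool (suc M))) →
  (true ∷ v) ∈ vs → v ∈ proj₂ (splitOnHead vs)
∈-splitOnHead-true ((true ∷ w) ∷ vs)  (here refl) = here refl
∈-splitOnHead-true ((true ∷ w) ∷ vs)  (there p)   = there (∈-splitOnHead-true vs p)
∈-splitOnHead-true ((false ∷ w) ∷ vs) (there p)   = ∈-splitOnHead-true vs p

∃-∉-Vec-Bool : ∀ M (vs : List (Vec Bool M)) → length vs < 2 ^ M → ∃ λ v → v ∉ vs
∃-∉-Vec-Bool zero    []      _         = [] , λ ()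
∃-∉-Vec-Bool zero    (_ ∷ _) (s≤s ())
∃-∉-Vec-Bool (suc M) vs      |vs|<2^[1+M] with length (proj₁ (splitOnHead vs)) <? 2 ^ M
... | yes few₀ = Product.map (false ∷_) (λ v∉ → v∉ ∘ ∈-splitOnHead-false vs) (∃-∉-Vec-Bool M _ few₀)
... | no  ≮2^M = Product.map (true ∷_) (λ v∉ → v∉ ∘ ∈-splitOnHead-true vs) (∃-∉-Vec-Bool M _ few₁)
  where
  few₁ : length (proj₂ (splitOnHead vs)) < 2 ^ M
  few₁ = +-cancelˡ-< (2 ^ M) _ _ (begin-strict
    2 ^ M + length (proj₂ (splitOnHead vs))                         ≤⟨ +-monoˡ-≤ _ (≮⇒≥ ≮2^M) ⟩
    length (proj₁ (splitOnHead vs)) + length (proj₂ (splitOnHead vs)) ≡⟨ length-splitOnHead vs ⟩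
    length vs                                                       <⟨ |vs|<2^[1+M] ⟩
    2 ^ M + (2 ^ M + 0)                                             ≡⟨ cong (2 ^ M +_) (+-identityʳ (2 ^ M)) ⟩
    2 ^ M + 2 ^ M                                                   ∎)
    where open ≤-Reasoning

-- 2 ^ suc n reduces to 2 ^ n + (2 ^ n + 0), hence the trailing [].
truthTable : ∀ n → B n → Vec Bool (2 ^ n)
truthTable zero    f = f (λ ()) ∷ []
truthTable (suc n) f = truthTable n (λ x → f (extend x false)) Vec.++ (truthTable n (λ x → f (extend x true)) Vec.++ [])

fromTruthTable : ∀ n → Vec Bool (2 ^ n) → B n
fromTruthTable zero    (b ∷ []) _ = b
fromTruthTable (suc n) t        x =
  if x zero then fromTruthTable n (take (2 ^ n) (drop (2 ^ n) t)) (x ∘ suc)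
            else fromTruthTable n (take (2 ^ n) t) (x ∘ suc)

truthTable-cong : ∀ n {f g : B n} → (∀ x → f x ≡ g x) → truthTable n f ≡ truthTable n g
truthTable-cong zero    f≗g = cong (_∷ []) (f≗g _)
truthTable-cong (suc n) f≗g = cong₂ (λ t₀ t₁ → t₀ Vec.++ (t₁ Vec.++ []))
  (truthTable-cong n (λ x → f≗g (extend x false))) (truthTable-cong n (λ x → f≗g (extend x true)))

truthTable-fromTruthTable : ∀ n (t : Vec Bool (2 ^ n)) → truthTable n (fromTruthTable n t) ≡ t
truthTable-fromTruthTable zero    (b ∷ []) = refl
truthTable-fromTruthTable (suc n) t        = begin
  truthTable n (fromTruthTable n (take m t)) Vec.++ (truthTable n (fromTruthTable n (take m t′)) Vec.++ [])
    ≡⟨ cong₂ (λ t₀ t₁ → t₀ Vec.++ (t₁ Vec.++ []))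
             (truthTable-fromTruthTable n _) (truthTable-fromTruthTable n _) ⟩
  take m t Vec.++ (take m t′ Vec.++ [])
    ≡⟨ cong (λ e → take m t Vec.++ (take m t′ Vec.++ e)) (empty (drop m t′)) ⟩
  take m t Vec.++ (take m t′ Vec.++ drop m t′)
    ≡⟨ cong (take m t Vec.++_) (take++drop≡id m t′) ⟩
  take m t Vec.++ drop m t
    ≡⟨ take++drop≡id m t ⟩
  t ∎
  where
  open ≡-Reasoning
  m = 2 ^ n
  t′ = drop m t
  empty : (e : Vec Bool 0) → [] ≡ e
  empty [] = refl

evalGate-cong : ∀ {j} (g : Gate j) {v w : Fin j → Bool} → v ≗ w → evalGate g v ≡ evalGate g w
evalGate-cong (AND a b) v≗w = cong₂ _∧_ (v≗w a) (v≗w b)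
evalGate-cong (OR a b)  v≗w = cong₂ _∨_ (v≗w a) (v≗w b)
evalGate-cong (NOT a)   v≗w = cong not (v≗w a)

val-cong : ∀ {n m} (C : Circ n m) {x y : Fin n → Bool} → x ≗ y → val C x ≗ val C y
val-cong []      x≗y = x≗y
val-cong (C ▷ g) x≗y zero    = evalGate-cong g (val-cong C x≗y)
val-cong (C ▷ g) x≗y (suc u) = val-cong C x≗y u

bools : List Bool
bools = false ∷ true ∷ []

∈-bools : ∀ b → b ∈ bools
∈-bools false = here refl
∈-bools true  = there (here refl)

∀-assignment? : ∀ {n} {P : (Fin n → Bool) → Set} → (∀ {x y} → x ≗ y → P x → P y) →
  Decidable P → Dec (∀ x → P x)
∀-assignment? {n} resp P? = map′
  (λ all x → resp (lookup∘tabulate x) (All.lookup all (∈-vectors ∈-bools (Vec.tabulate x))))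
  (λ ∀P → All.tabulate λ _ → ∀P _)
  (All.all? (P? ∘ Vec.lookup) (vectors bools n))

constant? : ∀ {n m} (C : Circ n m) u → Dec (ComputesConst C u)
constant? C u = map′ (λ c x y → trans (c x) (sym (c y))) (λ c x → c x _)
  (∀-assignment? (λ x≗y e → trans (sym (val-cong C x≗y u)) e)
                 (λ x → val C x u Bool.≟ val C (λ _ → false) u))

-- A stack machine

-- Programs are postfix expressions with back-references. push reads the memory cell named by
-- the next reference (cells 0 and 1 hold false and true, cells 2 .. n + 1 the inputs), and neg,
-- conj, disj also append their result to memory, so later pushes can reuse it. A missing
-- reference or stack operand leaves the state unchanged; these junk cases never arise below.
data Instr : Set where
  push skip neg conj disj : Instr

instrList : List Instr
instrList = push ∷ skip ∷ neg ∷ conj ∷ disj ∷ []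

∈-instrs : ∀ i → i ∈ instrList
∈-instrs push = here refl
∈-instrs skip = there (here refl)
∈-instrs neg  = there (there (here refl))
∈-instrs conj = there (there (there (here refl)))
∈-instrs disj = there (there (there (there (here refl))))

record State : Set where
  constructor ⟨_,_,_⟩
  field
    refs   : List ℕ
    stack  : List Bool
    memory : List Bool

fetch : List Bool → ℕ → Bool
fetch []       _       = false
fetch (b ∷ bs) zero    = b
fetch (b ∷ bs) (suc r) = fetch bs r

apply₂ : (Bool → Bool → Bool) → State → State
apply₂ _⊕_ ⟨ rs , b ∷ a ∷ st , mem ⟩ = ⟨ rs , a ⊕ b ∷ st , mem ∷ʳ (a ⊕ b) ⟩
apply₂ _⊕_ s                         = s

step : Instr → State → State
step push ⟨ r ∷ rs , st , mem ⟩ = ⟨ rs , fetch mem r ∷ st , mem ⟩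
step push s                     = s
step skip s                     = s
step neg  ⟨ rs , v ∷ st , mem ⟩ = ⟨ rs , not v ∷ st , mem ∷ʳ not v ⟩
step neg  s                     = s
step conj s                     = apply₂ _∧_ s
step disj s                     = apply₂ _∨_ s

exec : List Instr → State → State
exec is s = List.foldl (λ s i → step i s) s is

exec-++ : ∀ is js s → exec (is ++ js) s ≡ exec js (exec is s)
exec-++ is js s = foldl-++ (λ s i → step i s) s is js

exec-skips : ∀ j s → exec (replicate j skip) s ≡ s
exec-skips zero    s = refl
exec-skips (suc j) s = exec-skips j s

data Binary : Instr → (Bool → Bool → Bool) → Set where
  conj∧ : Binary conj _∧_
  disj∨ : Binary disj _∨_

step-Binary : ∀ {i _⊕_} → Binary i _⊕_ → ∀ s → step i s ≡ apply₂ _⊕_ s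
step-Binary conj∧ s = refl
step-Binary disj∨ s = refl

initialMemory : ∀ {n} → (Fin n → Bool) → List Bool
initialMemory x = false ∷ true ∷ tabulate x

Program : ℕ → ℕ → Set
Program n G = Vec Instr (suc (2 * G)) × Vec (Fin (2 + n + G)) (suc G)

top : List Bool → Bool
top []      = false
top (b ∷ _) = b

run : ∀ {n G} → Program n G → B n
run (is , rs) x = top (State.stack (exec (toList is) ⟨ map toℕ (toList rs) , [] , initialMemory x ⟩))

-- Compiling a circuit by depth-first search

data View {n m} (C : Circ n m) (u : Fin (m + n)) : Set where
  input    : (i : Fin n) → (∀ x → val C x u ≡ x i) → View C u
  binary   : ∀ {i _⊕_} → Binary i _⊕_ → (a b : Fin (m + n)) → u Fin.< a → u Fin.< b →
             (∀ x → val C x u ≡ (val C x a ⊕ val C x b)) → View C u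
  negation : (a : Fin (m + n)) → u Fin.< a → (∀ x → val C x u ≡ not (val C x a)) → View C u

view : ∀ {n m} (C : Circ n m) u → View C u
view []            u       = input u (λ _ → refl)
view (C ▷ AND a b) zero    = binary conj∧ (suc a) (suc b) z<s z<s (λ _ → refl)
view (C ▷ OR a b)  zero    = binary disj∨ (suc a) (suc b) z<s z<s (λ _ → refl)
view (C ▷ NOT a)   zero    = negation (suc a) z<s (λ _ → refl)
view (C ▷ g)       (suc u) with view C u
... | input i e                = input i e
... | binary op a b u<a u<b e = binary op (suc a) (suc b) (s≤s u<a) (s≤s u<b) e
... | negation a u<a e         = negation (suc a) (s≤s u<a) e

fetch-tabulate-++ : ∀ {j} (x : Fin j → Bool) ys (i : Fin j) → fetch (tabulate x ++ ys) (toℕ i) ≡ x i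
fetch-tabulate-++ x ys zero    = refl
fetch-tabulate-++ x ys (suc i) = fetch-tabulate-++ (x ∘ suc) ys i

fetch-tabulate-++ʳ : ∀ {j} (x : Fin j → Bool) ys k → fetch (tabulate x ++ ys) (j + k) ≡ fetch ys k
fetch-tabulate-++ʳ {zero}  x ys k = refl
fetch-tabulate-++ʳ {suc j} x ys k = fetch-tabulate-++ʳ (x ∘ suc) ys k

fetch-map-index : (g : X → Bool) {w : X} {ws : List X} (w∈ws : w ∈ ws) → fetch (map g ws) (toℕ (index w∈ws)) ≡ g w
fetch-map-index g (here refl)  = refl
fetch-map-index g (there w∈ws) = fetch-map-index g w∈ws

module Compilation {n m : ℕ} (C : Circ n m) where

  open import Data.List.Membership.DecPropositional (Fin._≟_ {m + n}) using (_∈?_)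

  Node : Set
  Node = Fin (m + n)

  NonConstant : Node → Set
  NonConstant u = ¬ ComputesConst C u

  memoryOf : (Fin n → Bool) → List Node → List Bool
  memoryOf x vis = initialMemory x ++ map (λ w → val C x w) vis

  memoryOf-∷ʳ : ∀ x vis u → memoryOf x vis ∷ʳ val C x u ≡ memoryOf x (vis ∷ʳ u)
  memoryOf-∷ʳ x vis u = trans (++-assoc (initialMemory x) _ _) (cong (initialMemory x ++_) (sym (map-++ _ vis [ u ])))

  store-result : ∀ x u {v} vis rs st → v ≡ val C x u →
    ⟨ rs , v ∷ st , memoryOf x vis ∷ʳ v ⟩ ≡ ⟨ rs , val C x u ∷ st , memoryOf x (vis ∷ʳ u) ⟩
  store-result x u vis rs st refl = cong (λ mem → ⟨ rs , val C x u ∷ st , mem ⟩) (memoryOf-∷ʳ x vis u)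

  record Compiled (u : Node) (vis : List Node) : Set where
    field
      instrs   : List Instr
      refs     : List ℕ
      visited  : List Node
      #new     : ℕ
      unique   : Unique visited
      -- arguments have larger indices than their gate, so u lies outside its own subprograms
      fresh    : ∀ {w} → w ∈ visited → w ∈ vis ⊎ (u Fin.≤ w × NonConstant w)
      #visited : length visited ≡ length vis + #new
      #instrs  : length instrs ≡ #new + length refs
      -- the expanded nodes form a tree of arity ≤ 2 whose leaves are the references
      #refs    : length refs ≤ suc #new
      inMemory : All (_< 2 + n + length visited) refs
      correct  : ∀ x rs st → exec instrs ⟨ refs ++ rs , st , memoryOf x vis ⟩
                           ≡ ⟨ rs , val C x u ∷ st , memoryOf x visited ⟩

  fresh-child : ∀ {u a : Node} {vis w} (c : Compiled a vis) → u Fin.< a → w ∈ Compiled.visited c →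
    w ∈ vis ⊎ (u Fin.≤ w × NonConstant w)
  fresh-child c u<a w∈ = Sum.map₂ (Product.map₁ (λ a≤w → <⇒≤ (<-≤-trans u<a a≤w))) (Compiled.fresh c w∈)

  ∉-visited : ∀ {u a : Node} {vis} (c : Compiled a vis) → u Fin.< a → u ∉ vis → u ∉ Compiled.visited c
  ∉-visited c u<a u∉vis u∈ with Compiled.fresh c u∈
  ... | inj₁ u∈vis       = u∉vis u∈vis
  ... | inj₂ (a≤u , _) = <⇒≱ u<a a≤u

  reference : ∀ {u vis} → Unique vis → (r : ℕ) → r < 2 + n + length vis →
    (∀ x → fetch (memoryOf x vis) r ≡ val C x u) → Compiled u vis
  reference {vis = vis} unique r r< fetch-r = record
    { instrs   = [ push ]
    ; refs     = [ r ]
    ; visited  = vis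
    ; #new     = 0
    ; unique   = unique
    ; fresh    = inj₁
    ; #visited = sym (+-identityʳ _)
    ; #instrs  = refl
    ; #refs    = ≤-refl
    ; inMemory = r< ∷ []
    ; correct  = λ x rs st → cong (λ v → ⟨ rs , v ∷ st , memoryOf x vis ⟩) (fetch-r x)
    }

  compileNeg : ∀ {u vis a} → u Fin.< a → (∀ x → val C x u ≡ not (val C x a)) → NonConstant u → u ∉ vis →
    Compiled a vis → Compiled u vis
  compileNeg {u} {vis} {a} u<a val-u nc u∉vis ca = record
    { instrs   = A.instrs ∷ʳ neg
    ; refs     = A.refs
    ; visited  = A.visited ∷ʳ u
    ; #new     = A.#new + 1
    ; unique   = Unique-∷ʳ A.unique (∉-visited ca u<a u∉vis)
    ; fresh    = fresh
    ; #visited = trans (length-++ A.visited) (trans (cong (_+ 1) A.#visited) (+-assoc (length vis) _ 1))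
    ; #instrs  = trans (length-++ A.instrs) (trans (cong (_+ 1) A.#instrs) (+-suc-move A.#new _))
    ; #refs    = ≤-trans A.#refs (s≤s (m≤m+n _ 1))
    ; inMemory = All.map (λ r< → <-≤-trans r< (+-monoʳ-≤ (2 + n) (length-++-≤ˡ A.visited))) A.inMemory
    ; correct  = correct
    }
    where
    module A = Compiled ca
    +-suc-move : ∀ p q → p + q + 1 ≡ p + 1 + q
    +-suc-move = solve-∀
    fresh : ∀ {w} → w ∈ A.visited ∷ʳ u → w ∈ vis ⊎ (u Fin.≤ w × NonConstant w)
    fresh w∈ with ∈-++⁻ A.visited w∈
    ... | inj₁ w∈A         = fresh-child ca u<a w∈A
    ... | inj₂ (here refl) = inj₂ (≤-refl , nc)
    correct : ∀ x rs st → exec (A.instrs ∷ʳ neg) ⟨ A.refs ++ rs , st , memoryOf x vis ⟩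
                        ≡ ⟨ rs , val C x u ∷ st , memoryOf x (A.visited ∷ʳ u) ⟩
    correct x rs st = begin
      exec (A.instrs ∷ʳ neg) ⟨ A.refs ++ rs , st , memoryOf x vis ⟩
        ≡⟨ exec-++ A.instrs _ _ ⟩
      step neg (exec A.instrs ⟨ A.refs ++ rs , st , memoryOf x vis ⟩)
        ≡⟨ cong (step neg) (A.correct x rs st) ⟩
      step neg ⟨ rs , val C x a ∷ st , memoryOf x A.visited ⟩
        ≡⟨ store-result x u A.visited rs st (sym (val-u x)) ⟩
      ⟨ rs , val C x u ∷ st , memoryOf x (A.visited ∷ʳ u) ⟩
        ∎
      where open ≡-Reasoning

  compileBinary : ∀ {u vis a b i _⊕_} → Binary i _⊕_ → u Fin.< a → u Fin.< b →
    (∀ x → val C x u ≡ (val C x a ⊕ val C x b)) → NonConstant u → u ∉ vis →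
    (ca : Compiled a vis) → Compiled b (Compiled.visited ca) → Compiled u vis
  compileBinary {u} {vis} {a} {b} {i} {_⊕_} op u<a u<b val-u nc u∉vis ca cb = record
    { instrs   = A.instrs ++ B.instrs ∷ʳ i
    ; refs     = A.refs ++ B.refs
    ; visited  = B.visited ∷ʳ u
    ; #new     = A.#new + B.#new + 1
    ; unique   = Unique-∷ʳ B.unique (∉-visited cb u<b (∉-visited ca u<a u∉vis))
    ; fresh    = fresh
    ; #visited = #visited
    ; #instrs  = #instrs
    ; #refs    = #refs
    ; inMemory = All.++⁺ (All.map (λ r< → <-≤-trans r< (+-monoʳ-≤ (2 + n) A≤)) A.inMemory)
                          (All.map (λ r< → <-≤-trans r< (+-monoʳ-≤ (2 + n) (length-++-≤ˡ B.visited))) B.inMemory)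
    ; correct  = correct
    }
    where
    module A = Compiled ca
    module B = Compiled cb

    fresh : ∀ {w} → w ∈ B.visited ∷ʳ u → w ∈ vis ⊎ (u Fin.≤ w × NonConstant w)
    fresh w∈ with ∈-++⁻ B.visited w∈
    ... | inj₂ (here refl) = inj₂ (≤-refl , nc)
    ... | inj₁ w∈B with fresh-child cb u<b w∈B
    ...   | inj₂ u≤w = inj₂ u≤w
    ...   | inj₁ w∈A = fresh-child ca u<a w∈A

    #visited : length (B.visited ∷ʳ u) ≡ length vis + (A.#new + B.#new + 1)
    #visited = begin
      length (B.visited ∷ʳ u)               ≡⟨ length-++ B.visited ⟩
      length B.visited + 1                  ≡⟨ cong (_+ 1) B.#visited ⟩
      length A.visited + B.#new + 1         ≡⟨ cong (λ l → l + B.#new + 1) A.#visited ⟩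
      length vis + A.#new + B.#new + 1      ≡⟨ reassoc (length vis) A.#new B.#new ⟩
      length vis + (A.#new + B.#new + 1)    ∎
      where
      open ≡-Reasoning
      reassoc : ∀ l p q → l + p + q + 1 ≡ l + (p + q + 1)
      reassoc = solve-∀

    #instrs : length (A.instrs ++ B.instrs ∷ʳ i) ≡ A.#new + B.#new + 1 + length (A.refs ++ B.refs)
    #instrs = begin
      length (A.instrs ++ B.instrs ∷ʳ i)                   ≡⟨ length-++ A.instrs ⟩
      length A.instrs + length (B.instrs ∷ʳ i)             ≡⟨ cong (length A.instrs +_) (length-++ B.instrs) ⟩
      length A.instrs + (length B.instrs + 1)              ≡⟨ cong₂ (λ p q → p + (q + 1)) A.#instrs B.#instrs ⟩
      A.#new + length A.refs + (B.#new + length B.refs + 1) ≡⟨ regroup A.#new B.#new (length A.refs) (length B.refs) ⟩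
      A.#new + B.#new + 1 + (length A.refs + length B.refs) ≡⟨ cong (A.#new + B.#new + 1 +_) (length-++ A.refs) ⟨
      A.#new + B.#new + 1 + length (A.refs ++ B.refs)       ∎
      where
      open ≡-Reasoning
      regroup : ∀ p q r s → p + r + (q + s + 1) ≡ p + q + 1 + (r + s)
      regroup = solve-∀

    #refs : length (A.refs ++ B.refs) ≤ suc (A.#new + B.#new + 1)
    #refs = begin
      length (A.refs ++ B.refs)         ≡⟨ length-++ A.refs ⟩
      length A.refs + length B.refs     ≤⟨ +-mono-≤ A.#refs B.#refs ⟩
      suc A.#new + suc B.#new           ≡⟨ regroup A.#new B.#new ⟩
      suc (A.#new + B.#new + 1)         ∎
      where
      open ≤-Reasoning
      regroup : ∀ p q → suc p + suc q ≡ suc (p + q + 1)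
      regroup = solve-∀

    A≤ : length A.visited ≤ length (B.visited ∷ʳ u)
    A≤ = begin
      length A.visited           ≤⟨ m≤m+n _ B.#new ⟩
      length A.visited + B.#new  ≡⟨ B.#visited ⟨
      length B.visited           ≤⟨ length-++-≤ˡ B.visited ⟩
      length (B.visited ∷ʳ u)    ∎
      where open ≤-Reasoning

    correct : ∀ x rs st → exec (A.instrs ++ B.instrs ∷ʳ i) ⟨ (A.refs ++ B.refs) ++ rs , st , memoryOf x vis ⟩
                        ≡ ⟨ rs , val C x u ∷ st , memoryOf x (B.visited ∷ʳ u) ⟩
    correct x rs st = begin
      exec (A.instrs ++ B.instrs ∷ʳ i) ⟨ (A.refs ++ B.refs) ++ rs , st , memoryOf x vis ⟩
        ≡⟨ cong (λ rs′ → exec (A.instrs ++ B.instrs ∷ʳ i) ⟨ rs′ , st , memoryOf x vis ⟩)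
                (++-assoc A.refs B.refs rs) ⟩
      exec (A.instrs ++ B.instrs ∷ʳ i) ⟨ A.refs ++ B.refs ++ rs , st , memoryOf x vis ⟩
        ≡⟨ exec-++ A.instrs _ _ ⟩
      exec (B.instrs ∷ʳ i) (exec A.instrs ⟨ A.refs ++ B.refs ++ rs , st , memoryOf x vis ⟩)
        ≡⟨ cong (exec (B.instrs ∷ʳ i)) (A.correct x (B.refs ++ rs) st) ⟩
      exec (B.instrs ∷ʳ i) ⟨ B.refs ++ rs , val C x a ∷ st , memoryOf x A.visited ⟩
        ≡⟨ exec-++ B.instrs _ _ ⟩
      step i (exec B.instrs ⟨ B.refs ++ rs , val C x a ∷ st , memoryOf x A.visited ⟩)
        ≡⟨ cong (step i) (B.correct x rs (val C x a ∷ st)) ⟩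
      step i ⟨ rs , val C x b ∷ val C x a ∷ st , memoryOf x B.visited ⟩
        ≡⟨ step-Binary op _ ⟩
      apply₂ _⊕_ ⟨ rs , val C x b ∷ val C x a ∷ st , memoryOf x B.visited ⟩
        ≡⟨ store-result x u B.visited rs st (sym (val-u x)) ⟩
      ⟨ rs , val C x u ∷ st , memoryOf x (B.visited ∷ʳ u) ⟩
        ∎
      where open ≡-Reasoning

  compile : ∀ u → Acc Fin._>_ u → ∀ vis → Unique vis → Compiled u vis
  compile u (acc rec) vis unique with view C u | constant? C u | u ∈? vis
  ... | input i val-u | _ | _ =
    reference unique (2 + toℕ i) (s≤s (s≤s (m≤n⇒m≤n+o _ (toℕ<n i))))
      (λ x → trans (fetch-tabulate-++ x _ i) (sym (val-u x)))
  ... | _ | yes const | _ =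
    reference unique (constSlot b) (constSlot< b) (λ x → trans (fetch-constSlot x b) (const _ x))
    where
    b = val C (λ _ → false) u
    constSlot : Bool → ℕ
    constSlot false = 0
    constSlot true  = 1
    constSlot< : ∀ b → constSlot b < 2 + n + length vis
    constSlot< false = s≤s z≤n
    constSlot< true  = s≤s (s≤s z≤n)
    fetch-constSlot : ∀ x b → fetch (memoryOf x vis) (constSlot b) ≡ b
    fetch-constSlot x false = refl
    fetch-constSlot x true  = refl
  ... | _ | no _ | yes u∈vis =
    reference unique (2 + n + toℕ (index u∈vis)) (+-monoʳ-< (2 + n) (toℕ<n (index u∈vis)))
      (λ x → trans (fetch-tabulate-++ʳ x _ _) (fetch-map-index (λ w → val C x w) u∈vis))
  ... | binary op a b u<a u<b val-u | no nc | no u∉vis =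
    compileBinary op u<a u<b val-u nc u∉vis ca (compile b (rec u<b) (Compiled.visited ca) (Compiled.unique ca))
    where ca = compile a (rec u<a) vis unique
  ... | negation a u<a val-u | no nc | no u∉vis =
    compileNeg u<a val-u nc u∉vis (compile a (rec u<a) vis unique)

  compileOutput : ∀ u → Compiled u []
  compileOutput u = compile u (>-wellFounded u) [] []

-- Counting the functions computed by short programs

padTo : (k : ℕ) → X → List X → Vec X k
padTo zero    a xs       = []
padTo (suc k) a []       = a ∷ padTo k a []
padTo (suc k) a (x ∷ xs) = x ∷ padTo k a xs

toList-padTo : ∀ k (a : X) xs → length xs ≤ k → toList (padTo k a xs) ≡ xs ++ replicate (k ∸ length xs) a
toList-padTo zero    a []       z≤n      = refl
toList-padTo (suc k) a []       _        = cong (a ∷_) (toList-padTo k a [] z≤n)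
toList-padTo (suc k) a (x ∷ xs) (s≤s le) = cong (x ∷_) (toList-padTo k a xs le)

toFins : ∀ {R} (rs : List ℕ) → All (_< R) rs → List (Fin R)
toFins []       []          = []
toFins (r ∷ rs) (r< ∷ rs<) = fromℕ< r< ∷ toFins rs rs<

map-toℕ-toFins : ∀ {R} (rs : List ℕ) (rs< : All (_< R) rs) → map toℕ (toFins rs rs<) ≡ rs
map-toℕ-toFins []       []          = refl
map-toℕ-toFins (r ∷ rs) (r< ∷ rs<) = cong₂ _∷_ (toℕ-fromℕ< r<) (map-toℕ-toFins rs rs<)

programs : ∀ n G → List (Program n G)
programs n G = cartesianProduct (vectors instrList (suc (2 * G))) (vectors (allFin (2 + n + G)) (suc G))

∈-programs : ∀ {n G} (p : Program n G) → p ∈ programs n G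
∈-programs (is , rs) = ∈-cartesianProduct⁺ (∈-vectors ∈-instrs is) (∈-vectors ∈-allFin rs)

tables : ∀ n G → List (Vec Bool (2 ^ n))
tables n G = map (truthTable n ∘ run) (programs n G)

length-tables : ∀ n G → length (tables n G) ≡ 5 ^ suc (2 * G) * (2 + n + G) ^ suc G
length-tables n G = begin
  length (tables n G)
    ≡⟨ length-map _ (programs n G) ⟩
  length (programs n G)
    ≡⟨ length-cartesianProductWith _,_ (vectors instrList (suc (2 * G))) _ ⟩
  length (vectors instrList (suc (2 * G))) * length (vectors (allFin (2 + n + G)) (suc G))
    ≡⟨ cong₂ _*_ (length-vectors instrList (suc (2 * G))) (length-vectors (allFin (2 + n + G)) (suc G)) ⟩
  5 ^ suc (2 * G) * length (allFin (2 + n + G)) ^ suc G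
    ≡⟨ cong (λ l → 5 ^ suc (2 * G) * l ^ suc G) (length-tabulate (λ i → i)) ⟩
  5 ^ suc (2 * G) * (2 + n + G) ^ suc G
    ∎
  where open ≡-Reasoning

module _ (T : Support) (k : ℕ) where

  length≤complexity : ∀ {n m} (C : Circ n m) (h : Embedding T C) → IsKLayer T k C h →
    {ws : List (Fin (m + n))} → Unique ws → (∀ {w} → w ∈ ws → ¬ ComputesConst C w) →
    length ws ≤ complexity T C h
  length≤complexity {n} {m} C h layered {ws} unique nonConst = begin
    length ws           ≡⟨ length-map enc ws ⟨
    length (map enc ws) ≤⟨ Unique⇒length-mono-⊆ (Unique-map⁺ inj unique) ⊆complexity ⟩
    complexity T C h    ∎
    where
    open ≤-Reasoning
    enc : Fin (m + n) → ℕ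
    enc = encV T ∘ hV h
    inj : ∀ {u v} → u ∈ ws → v ∈ ws → enc u ≡ enc v → u ≡ v
    inj u∈ v∈ e = proj₁ layered _ _ (encV-inj T e) (nonConst u∈) (nonConst v∈)
    ⊆complexity : map enc ws ⊆ deduplicate Data.Nat._≟_ (map enc (allFin (m + n)))
    ⊆complexity = ∈-deduplicate⁺ Data.Nat._≟_ ∘ Subset.map⁺ enc (λ {w} _ → ∈-allFin w)
      where import Data.Nat

  circuit⇒program : ∀ {n m G} (C : Circ n m) (o : Fin (m + n)) (h : Embedding T C) → IsKLayer T k C h →
    complexity T C h ≤ G → Σ[ p ∈ Program n G ] (∀ x → run p x ≡ val C x o)
  circuit⇒program {n} {m} {G} C o h layered c≤G = (is , rs) , runs
    where
    open Compilation C
    module O = Compiled (compileOutput o)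

    #visited≤G : length O.visited ≤ G
    #visited≤G = ≤-trans (length≤complexity C h layered O.unique nonConst) c≤G
      where
      nonConst : ∀ {w} → w ∈ O.visited → NonConstant w
      nonConst w∈ with O.fresh w∈
      ... | inj₂ (_ , nc) = nc

    #new≤G : O.#new ≤ G
    #new≤G = subst (_≤ G) O.#visited #visited≤G

    refs< : All (_< 2 + n + G) O.refs
    refs< = All.map (λ r< → <-≤-trans r< (+-monoʳ-≤ (2 + n) #visited≤G)) O.inMemory

    fins = toFins O.refs refs<

    #fins≤ : length fins ≤ suc G
    #fins≤ = begin
      length fins            ≡⟨ length-map toℕ fins ⟨
      length (map toℕ fins)  ≡⟨ cong length (map-toℕ-toFins O.refs refs<) ⟩
      length O.refs          ≤⟨ O.#refs ⟩
      suc O.#new             ≤⟨ s≤s #new≤G ⟩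
      suc G                  ∎
      where open ≤-Reasoning

    #instrs≤ : length O.instrs ≤ suc (2 * G)
    #instrs≤ = begin
      length O.instrs        ≡⟨ O.#instrs ⟩
      O.#new + length O.refs ≤⟨ +-mono-≤ #new≤G (≤-trans O.#refs (s≤s #new≤G)) ⟩
      G + suc G              ≡⟨ +-suc G G ⟩
      suc (G + G)            ≡⟨ cong (λ g → suc (G + g)) (+-identityʳ G) ⟨
      suc (2 * G)            ∎
      where open ≤-Reasoning

    is = padTo (suc (2 * G)) skip O.instrs
    rs = padTo (suc G) zero fins
    skips = replicate (suc (2 * G) ∸ length O.instrs) skip
    junk = map toℕ (replicate (suc G ∸ length fins) zero)

    refs≡ : map toℕ (toList rs) ≡ O.refs ++ junk
    refs≡ = trans (cong (map toℕ) (toList-padTo (suc G) zero fins #fins≤))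
                  (trans (map-++ toℕ fins _) (cong (_++ junk) (map-toℕ-toFins O.refs refs<)))

    runs : ∀ x → run (is , rs) x ≡ val C x o
    runs x = begin
      run (is , rs) x
        ≡⟨ cong₂ (λ is′ rs′ → top (State.stack (exec is′ ⟨ rs′ , [] , initialMemory x ⟩)))
                 (toList-padTo (suc (2 * G)) skip O.instrs #instrs≤) refs≡ ⟩
      top (State.stack (exec (O.instrs ++ skips) ⟨ O.refs ++ junk , [] , initialMemory x ⟩))
        ≡⟨ cong (top ∘ State.stack) (trans (exec-++ O.instrs skips _) (exec-skips (suc (2 * G) ∸ length O.instrs) _)) ⟩
      top (State.stack (exec O.instrs ⟨ O.refs ++ junk , [] , initialMemory x ⟩))
        ≡⟨ cong (λ mem → top (State.stack (exec O.instrs ⟨ O.refs ++ junk , [] , mem ⟩))) (++-identityʳ _) ⟨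
      top (State.stack (exec O.instrs ⟨ O.refs ++ junk , [] , memoryOf x [] ⟩))
        ≡⟨ cong (top ∘ State.stack) (O.correct x junk []) ⟩
      val C x o
        ∎
      where open ≡-Reasoning

  hardFunction : ∀ n G → length (tables n G) < 2 ^ 2 ^ n →
    Σ[ f ∈ B n ] (∀ m (C : Circ n m) o h → IsKLayer T k C h → Computes C o f → G < complexity T C h)
  hardFunction n G short = fromTruthTable n t , large
    where
    t∉ = ∃-∉-Vec-Bool (2 ^ n) (tables n G) short
    t = proj₁ t∉
    large : ∀ m (C : Circ n m) o h → IsKLayer T k C h → Computes C o (fromTruthTable n t) → G < complexity T C h
    large m C o h layered computes with complexity T C h ≤? G
    ... | no  c≰G = ≰⇒> c≰G
    ... | yes c≤G = contradiction (subst (_∈ tables n G) table≡t (∈-map⁺ _ (∈-programs p))) (proj₂ t∉)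
      where
      p = proj₁ (circuit⇒program C o h layered c≤G)
      table≡t : truthTable n (run p) ≡ t
      table≡t = trans (truthTable-cong n (λ x → trans (proj₂ (circuit⇒program C o h layered c≤G) x) (computes x)))
                      (truthTable-fromTruthTable n t)

-- Arithmetic

[10+j]³<2^[10+j] : ∀ j → (10 + j) * (10 + j) * (10 + j) < 2 ^ (10 + j)
[10+j]³<2^[10+j] zero    = m≤m+n 1001 23
[10+j]³<2^[10+j] (suc j) = begin-strict
  (11 + j) * (11 + j) * (11 + j)                                        ≤⟨ m≤m+n _ _ ⟩
  (11 + j) * (11 + j) * (11 + j) + (669 + 237 * j + 27 * (j * j) + j * j * j) ≡⟨ doubling j ⟨
  2 * ((10 + j) * (10 + j) * (10 + j))                                  <⟨ *-monoʳ-< 2 ([10+j]³<2^[10+j] j) ⟩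
  2 * 2 ^ (10 + j)                                                      ∎
  where
  open ≤-Reasoning
  doubling : ∀ j → 2 * ((10 + j) * (10 + j) * (10 + j))
               ≡ (11 + j) * (11 + j) * (11 + j) + (669 + 237 * j + 27 * (j * j) + j * j * j)
  doubling = solve-∀

n³<2^n : ∀ {n} → 10 ≤ n → n * n * n < 2 ^ n
n³<2^n {n} 10≤n = subst (λ n → n * n * n < 2 ^ n) (m+[n∸m]≡n 10≤n) ([10+j]³<2^[10+j] (n ∸ 10))

[1+d]n[n+3]<2^n : ∀ d {n} → 10 ≤ n → d + 4 ≤ n → suc d * n * (n + 3) < 2 ^ n
[1+d]n[n+3]<2^n d {n} 10≤n d+4≤n = begin-strict
  suc d * n * (n + 3)   ≡⟨ *-assoc (suc d) n (n + 3) ⟩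
  suc d * (n * (n + 3)) ≡⟨ cong (suc d *_) (*-comm n (n + 3)) ⟩
  suc d * ((n + 3) * n) ≡⟨ *-assoc (suc d) (n + 3) n ⟨
  suc d * (n + 3) * n   ≤⟨ *-monoˡ-≤ n [1+d][n+3]≤n² ⟩
  n * n * n             <⟨ n³<2^n 10≤n ⟩
  2 ^ n                 ∎
  where
  open ≤-Reasoning
  t = n ∸ (d + 4)
  square : ∀ d t → (d + 4 + t) * (d + 4 + t) ≡ suc d * (d + 4 + t + 3) + (9 + d * t + 7 * t + t * t)
  square = solve-∀
  [1+d][n+3]≤n² : suc d * (n + 3) ≤ n * n
  [1+d][n+3]≤n² = subst (λ n → suc d * (n + 3) ≤ n * n) (m+[n∸m]≡n d+4≤n)
    (≤-trans (m≤m+n _ _) (≤-reflexive (sym (square d t))))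

programBits<2^n : ∀ d n G → 6 * d + 1 ≤ n → suc d * n * (n + 3) < 2 ^ n → G * (suc d * n) ≤ d * 2 ^ n →
  3 * suc (2 * G) + n * suc G < 2 ^ n
programBits<2^n d n G 6d+1≤n poly<2^n G≤ = *-cancelˡ-< K _ _ (begin-strict
  K * (3 * suc (2 * G) + n * suc G)           ≡⟨ expand d n G ⟩
  (n + 6) * (G * K) + K * (n + 3)             ≤⟨ +-monoˡ-≤ _ (*-monoʳ-≤ (n + 6) G≤) ⟩
  (n + 6) * (d * P) + K * (n + 3)             <⟨ +-monoʳ-< _ poly<2^n ⟩
  (n + 6) * (d * P) + P                       ≤⟨ m≤m+n _ (t * P) ⟩
  (n + 6) * (d * P) + P + t * P               ≡⟨ cong (λ n → (n + 6) * (d * P) + P + t * P) n≡ ⟨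
  (6 * d + 1 + t + 6) * (d * P) + P + t * P   ≡⟨ collect d t P ⟩
  suc d * (6 * d + 1 + t) * P                 ≡⟨ cong (λ n → suc d * n * P) n≡ ⟩
  K * P                                       ∎)
  where
  open ≤-Reasoning
  K = suc d * n
  P = 2 ^ n
  t = n ∸ (6 * d + 1)
  n≡ : 6 * d + 1 + t ≡ n
  n≡ = m+[n∸m]≡n 6d+1≤n
  expand : ∀ d n G → suc d * n * (3 * suc (2 * G) + n * suc G) ≡ (n + 6) * (G * (suc d * n)) + suc d * n * (n + 3)
  expand = solve-∀
  collect : ∀ d t P → (6 * d + 1 + t + 6) * (d * P) + P + t * P ≡ suc d * (6 * d + 1 + t) * P
  collect = solve-∀

#programs<2^2^n : ∀ n G → 3 * suc (2 * G) + n * suc G < 2 ^ n → 5 ^ suc (2 * G) * (2 + n + G) ^ suc G < 2 ^ 2 ^ n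
#programs<2^2^n n G bits<2^n = begin-strict
  5 ^ suc (2 * G) * (2 + n + G) ^ suc G
    ≤⟨ *-mono-≤ (^-monoˡ-≤ (suc (2 * G)) (m≤m+n 5 3)) (^-monoˡ-≤ (suc G) R≤2^n) ⟩
  (2 ^ 3) ^ suc (2 * G) * (2 ^ n) ^ suc G
    ≡⟨ cong₂ _*_ (^-*-assoc 2 3 (suc (2 * G))) (^-*-assoc 2 n (suc G)) ⟩
  2 ^ (3 * suc (2 * G)) * 2 ^ (n * suc G)
    ≡⟨ ^-distribˡ-+-* 2 (3 * suc (2 * G)) (n * suc G) ⟨
  2 ^ (3 * suc (2 * G) + n * suc G)
    <⟨ ^-monoʳ-< 2 (s≤s (s≤s z≤n)) bits<2^n ⟩
  2 ^ 2 ^ n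
    ∎
  where
  open ≤-Reasoning
  split : ∀ n G → 3 * suc (2 * G) + n * suc G ≡ (2 + n + G) + (1 + 5 * G + n * G)
  split = solve-∀
  R≤2^n : 2 + n + G ≤ 2 ^ n
  R≤2^n = <⇒≤ (≤-<-trans (≤-trans (m≤m+n _ _) (≤-reflexive (sym (split n G)))) bits<2^n)

length-tables<2^2^n : ∀ d n G → 10 + 6 * d ≤ n → G * (suc d * n) ≤ d * 2 ^ n → length (tables n G) < 2 ^ 2 ^ n
length-tables<2^2^n d n G N≤n G≤ = subst (_< 2 ^ 2 ^ n) (sym (length-tables n G))
  (#programs<2^2^n n G (programBits<2^n d n G 6d+1≤n ([1+d]n[n+3]<2^n d 10≤n d+4≤n) G≤))
  where
  10≤n : 10 ≤ n
  10≤n = ≤-trans (m≤m+n 10 (6 * d)) N≤n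
  6d+1≤n : 6 * d + 1 ≤ n
  6d+1≤n = ≤-trans (≤-reflexive (+-comm (6 * d) 1)) (≤-trans (+-monoˡ-≤ (6 * d) (s≤s {0} {9} z≤n)) N≤n)
  d+4≤n : d + 4 ≤ n
  d+4≤n = ≤-trans (≤-reflexive (+-comm d 4)) (≤-trans (+-mono-≤ {4} {10} (m≤m+n 4 6) (m≤n*m d 6)) N≤n)

m/n<o⇒m<n*o : ∀ m n {o} .{{_ : NonZero n}} → m / n < o → m < n * o
m/n<o⇒m<n*o m n {o} m/n<o = begin-strict
  m                   ≡⟨ m≡m%n+[m/n]*n m n ⟩
  m % n + m / n * n   <⟨ +-monoˡ-< (m / n * n) (m%n<n m n) ⟩
  suc (m / n) * n     ≤⟨ *-monoˡ-≤ n m/n<o ⟩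
  o * n               ≡⟨ *-comm o n ⟩
  n * o               ∎
  where open ≤-Reasoning

lemma6 : (T : Support) (k : ℕ) (d : ℕ) →
    Σ[ N ∈ ℕ ] (∀ (n : ℕ) → N ≤ n →
      Σ[ f ∈ B n ] (∀ (m : ℕ) (C : Circ n m) (o : Fin (m + n)) (h : Embedding T C) →
        IsKLayer T k C h → Computes C o f →
          d * 2 ^ n ≤ suc d * n * complexity T C h))
lemma6 T k d = 10 + 6 * d , hard
  where
  hard : ∀ n → 10 + 6 * d ≤ n →
    Σ[ f ∈ B n ] (∀ m (C : Circ n m) o h → IsKLayer T k C h → Computes C o f →
      d * 2 ^ n ≤ suc d * n * complexity T C h)
  hard zero    ()
  hard n@(suc _) N≤n = Product.map₂ (λ G<c m C o h layered → <⇒≤ ∘ G<⇒bound ∘ G<c m C o h layered)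
    (hardFunction T k n G (length-tables<2^2^n d n G N≤n (m/n*n≤m (d * 2 ^ n) (suc d * n))))
    where
    G = d * 2 ^ n / (suc d * n)
    G<⇒bound : ∀ {c} → G < c → d * 2 ^ n < suc d * n * c
    G<⇒bound = m/n<o⇒m<n*o (d * 2 ^ n) (suc d * n)
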